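{- For the subset sum problem with positive integer weights $w_1\ge\dots\ge w_n$ and positive integer capacity $C$, any two distinct leaf $0$-tuples of its MBnB tree are incomparable in the componentwise order on $\{0,1\}^n$.
   Context: Let $N=\{1,\dots,n\}$, $W=\sum_{i\in N}w_i$. A map is a pair $(I,\theta)$ with $I\subseteq N$, $\theta:I\to\{0,1\}$. It satisfies the C0-condition if $\sum_{i\in I}\theta(i)w_i>C$, and the C1-condition if $\sum_{i\in I}(1-\theta(i))w_i\ge W-C$. The MBnB tree: the root is $(\emptyset,\emptyset)$; a node satisfying the C0- or C1-condition is a leaf; otherwise (then $I\ne N$) with $i$ the smallest index of $N\setminus I$ the node has two children $(I\cup\{i\},\theta_0)$, $(I\cup\{i\},\theta_1)$ where $\theta_k$ extends $\theta$ by $\theta_k(i)=k$. For a leaf $(I,\theta)$ satisfying the C0-condition, its leaf $0$-tuple is $z\in\{0,1\}^n$ with $z_i=\theta(i)$ for $i\in I$ and $z_i=0$ for $i\notin I$. For a leaf satisfying the C1-condition, its leaf $1$-tuple is $z$ with $z_i=\theta(i)$ for $i\in I$ and $z_i=1$ for $i\notin I$. The order on $\{0,1\}^n$ is $\tilde\alpha\le\tilde\beta$ iff $\alpha_i\le\beta_i$ for all $i$. -}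

module Defs where

open import Data.Nat using (ℕ; zero; suc; _+_; _*_; _≤_; _<_)
open import Data.Bool using (Bool; true; false)
import Data.Bool as B
open import Data.Maybe using (Maybe; just; nothing)
open import Data.Fin using (Fin; _≟_)
import Data.Fin as F
open import Data.Vec using (Vec; tabulate; sum)
open import Data.Vec.Relation.Binary.Pointwise.Inductive using (Pointwise)
open import Data.Product using (_×_)
open import Data.Sum using (_⊎_)
open import Relation.Nullary using (¬_; yes; no)
open import Relation.Binary.PropositionalEquality using (_≡_; _≢_)

-- A map (I , θ) with I ⊆ N, θ : I → {0,1} is encoded as a partial function:
-- μ i ≡ nothing  means i ∉ I;  μ i ≡ just b  means i ∈ I and θ(i) = b.
Map : ℕ → Set
Map n = Fin n → Maybe Bool

Σ[_] : ∀ {n} → (Fin n → ℕ) → ℕ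
Σ[ f ] = sum (tabulate f)

totalW : ∀ {n} → (Fin n → ℕ) → ℕ
totalW w = Σ[ w ]

ones : ∀ {n} → (Fin n → ℕ) → Map n → Fin n → ℕ
ones w μ i with μ i
... | just true  = w i
... | just false = 0
... | nothing    = 0

zeros : ∀ {n} → (Fin n → ℕ) → Map n → Fin n → ℕ
zeros w μ i with μ i
... | just true  = 0
... | just false = w i
... | nothing    = 0

C0 : ∀ {n} → (Fin n → ℕ) → ℕ → Map n → Set
C0 w C μ = C < Σ[ ones w μ ]

-- C1-condition: Σ_{i∈I} (1-θ(i)) w_i ≥ W - C  (stated over ℕ as  Σ + C ≥ W,
-- which is equivalent to the integer inequality)
C1 : ∀ {n} → (Fin n → ℕ) → ℕ → Map n → Set
C1 w C μ = totalW w ≤ Σ[ zeros w μ ] + C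

root : ∀ {n} → Map n
root _ = nothing

SmallestFree : ∀ {n} → Map n → Fin n → Set
SmallestFree μ i = (μ i ≡ nothing) × (∀ j → j F.< i → μ j ≢ nothing)

extend : ∀ {n} → Map n → Fin n → Bool → Map n
extend μ i k j with j ≟ i
... | yes _ = just k
... | no  _ = μ j

data InTree {n : ℕ} (w : Fin n → ℕ) (C : ℕ) : Map n → Set where
  rootIn  : InTree w C root
  childIn : ∀ {μ} → InTree w C μ → ¬ C0 w C μ → ¬ C1 w C μ →
            ∀ i → SmallestFree μ i → (k : Bool) → InTree w C (extend μ i k)

zeroTuple : ∀ {n} → Map n → Vec Bool n
zeroTuple μ = tabulate λ i → f (μ i)
  where
  f : Maybe Bool → Bool
  f (just b) = b
  f nothing  = false

IsLeaf0Tuple : ∀ {n} → (Fin n → ℕ) → ℕ → Vec Bool n → Set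
IsLeaf0Tuple w C z = Data.Product.Σ (Map _) λ μ →
  InTree w C μ × C0 w C μ × zeroTuple μ ≡ z

_≤ᵥ_ : ∀ {n} → Vec Bool n → Vec Bool n → Set
α ≤ᵥ β = Pointwise B._≤_ α β

Incomparable : ∀ {n} → Vec Bool n → Vec Bool n → Set
Incomparable α β = ¬ (α ≤ᵥ β) × ¬ (β ≤ᵥ α)

module Submission where

open import Defs
open import Data.Nat using (ℕ; _≤_; _<_)
open import Data.Fin using (Fin)
import Data.Fin as F
open import Data.Bool using (Bool)
open import Data.Vec using (Vec)
open import Relation.Binary.PropositionalEquality using (_≢_)

-- Encode a leaf 0-tuple as a bit vector a : Fin n → Bool and
-- write weight a = Σ_{a i} w i.  Every node of the MBnB tree is defined
-- exactly on a prefix {0,…,m-1} of the indices, so a leaf satisfying the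
-- C0-condition arises from a parent that did not, by setting the next free
-- bit q to 1.  Hence its 0-tuple a is "critical at q": a q = 1, a vanishes
-- beyond q, weight a > C, and the weight of a restricted to indices < q is
-- ≤ C.  For two critical vectors a ≤ b (at q and q') one shows q = q'
-- (a larger critical index for b would give weight a ≤ weight (b below q') ≤ C),
-- and then a = b: a position p with a p = 0 < 1 = b p lies below q, so by
-- antitonicity w q ≤ w p and weight a ≤ weight (a below q) + w q
-- ≤ weight (a below q) + w p ≤ weight (b below q) ≤ C, a contradiction.

open import Data.Nat using (zero; suc; _+_; z≤n; s≤s⁻¹)
open import Data.Nat.Properties
  using (≤-refl; ≤-trans; ≤-antisym; ≤∧≢⇒<; ≤-reflexive; +-mono-≤; +-monoʳ-≤; +-assoc;
         +-commutativeSemigroup; +-identityʳ; <⇒≤; <⇒≱; ≰⇒>; ≮⇒≥; <-≤-trans; <-irrefl;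
         module ≤-Reasoning)
open import Algebra.Properties.CommutativeSemigroup +-commutativeSemigroup
  using (xy∙z≈xz∙y)
open import Data.Fin using (toℕ; fromℕ<)
open import Data.Fin.Properties using (suc-injective; toℕ-injective; toℕ<n; toℕ-fromℕ<; _<?_)
import Data.Fin.Properties as FP
open import Data.Bool using (true; false; if_then_else_)
import Data.Bool as B
open import Data.Maybe using (just; nothing; fromMaybe)
open import Data.Vec using (_∷_; []; head; tabulate; sum)
open import Data.Vec.Properties using (tabulate-cong)
open import Data.Vec.Relation.Binary.Pointwise.Inductive using (tabulate⁻)
open import Data.Product using (_×_; _,_; ∃; ∃-syntax)
open import Function using (_∘_)
open import Relation.Nullary using (¬_; yes; no; contradiction)
open import Relation.Binary.PropositionalEquality
  using (_≡_; refl; sym; trans; cong; subst; _≗_; module ≡-Reasoning)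

Σ-mono : ∀ {n} (f h : Fin n → ℕ) → (∀ i → f i ≤ h i) → Σ[ f ] ≤ Σ[ h ]
Σ-mono {zero}  f h f≤h = z≤n
Σ-mono {suc n} f h f≤h =
  +-mono-≤ (f≤h F.zero) (Σ-mono (f ∘ F.suc) (h ∘ F.suc) (f≤h ∘ F.suc))

Σ-cong : ∀ {n} {f h : Fin n → ℕ} → f ≗ h → Σ[ f ] ≡ Σ[ h ]
Σ-cong f≗h = cong sum (tabulate-cong f≗h)

-- Monotonicity with one exceptional index p, where slack terms d and e are
-- allowed: used both to add and to remove a single weight from a sum.
Σ-mono-except : ∀ {n} (f h : Fin n → ℕ) (p : Fin n) {d e : ℕ} →
  (∀ i → i ≢ p → f i ≤ h i) → f p + d ≤ h p + e → Σ[ f ] + d ≤ Σ[ h ] + e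
Σ-mono-except {suc n} f h F.zero {d} {e} f≤h at-p = begin
  f F.zero + Σ[ f ∘ F.suc ] + d   ≡⟨ xy∙z≈xz∙y (f F.zero) _ d ⟩
  f F.zero + d + Σ[ f ∘ F.suc ]   ≤⟨ +-mono-≤ at-p (Σ-mono _ _ (λ i → f≤h (F.suc i) (λ ()))) ⟩
  h F.zero + e + Σ[ h ∘ F.suc ]   ≡⟨ xy∙z≈xz∙y (h F.zero) _ e ⟨
  h F.zero + Σ[ h ∘ F.suc ] + e   ∎
  where open ≤-Reasoning
Σ-mono-except {suc n} f h (F.suc p) {d} {e} f≤h at-p = begin
  f F.zero + Σ[ f ∘ F.suc ] + d   ≡⟨ +-assoc (f F.zero) _ d ⟩
  f F.zero + (Σ[ f ∘ F.suc ] + d) ≤⟨ +-mono-≤ (f≤h F.zero (λ ()))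
                                    (Σ-mono-except _ _ p (λ i i≢p → f≤h (F.suc i) (i≢p ∘ suc-injective)) at-p) ⟩
  h F.zero + (Σ[ h ∘ F.suc ] + e) ≡⟨ +-assoc (h F.zero) _ e ⟨
  h F.zero + Σ[ h ∘ F.suc ] + e   ∎
  where open ≤-Reasoning

bits : ∀ {n} → Map n → Fin n → Bool
bits μ i = fromMaybe false (μ i)

zeroTuple-tabulate : ∀ {n} (μ : Map n) → zeroTuple μ ≡ tabulate (bits μ)
zeroTuple-tabulate μ = tabulate-cong (λ i → cong head (single (μ i)))
  where
  single : ∀ x → zeroTuple (λ (_ : Fin 1) → x) ≡ fromMaybe false x ∷ []
  single (just b) = refl
  single nothing  = refl

below : ∀ {n} → Fin n → (Fin n → Bool) → Fin n → Bool
below q a i with i <? q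
... | yes _ = a i
... | no  _ = false

below-< : ∀ {n} {q i : Fin n} (a : Fin n → Bool) → i F.< q → below q a i ≡ a i
below-< {q = q} {i} a i<q with i <? q
... | yes _   = refl
... | no  i≮q = contradiction i<q i≮q

below-≥ : ∀ {n} {q i : Fin n} (a : Fin n → Bool) → q F.≤ i → below q a i ≡ false
below-≥ {q = q} {i} a q≤i with i <? q
... | yes i<q = contradiction q≤i (<⇒≱ i<q)
... | no  _   = refl

true≤⇒true : ∀ {x} → true B.≤ x → x ≡ true
true≤⇒true B.b≤b = refl

below-mono : ∀ {n} (q : Fin n) {a b : Fin n → Bool} →
  (∀ i → a i B.≤ b i) → ∀ i → below q a i B.≤ below q b i
below-mono q a≤b i with i <? q
... | yes _ = a≤b i
... | no  _ = B.b≤b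

module Weight {n : ℕ} (w : Fin n → ℕ) where

  select : Bool → Fin n → ℕ
  select x i = if x then w i else 0

  select-mono : ∀ {x y} i → x B.≤ y → select x i ≤ select y i
  select-mono i B.f≤t = z≤n
  select-mono i B.b≤b = ≤-refl

  weight : (Fin n → Bool) → ℕ
  weight a = Σ[ (λ i → select (a i) i) ]

  weight-mono : ∀ {a b} → (∀ i → a i B.≤ b i) → weight a ≤ weight b
  weight-mono a≤b = Σ-mono _ _ (λ i → select-mono i (a≤b i))

  weight-cong : ∀ {a b} → a ≗ b → weight a ≡ weight b
  weight-cong a≗b = Σ-cong (λ i → cong (λ x → select x i) (a≗b i))

  ones-weight : (μ : Map n) → Σ[ ones w μ ] ≡ weight (bits μ)
  ones-weight μ = Σ-cong pointwise
    where
    pointwise : ∀ i → ones w μ i ≡ select (bits μ i) i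
    pointwise i with μ i
    ... | just true  = refl
    ... | just false = refl
    ... | nothing    = refl

  weight-empty : weight (λ _ → false) ≡ 0
  weight-empty = empty n
    where
    empty : ∀ m → Σ[ (λ (_ : Fin m) → 0) ] ≡ 0
    empty zero    = refl
    empty (suc m) = empty m

  weight-add : ∀ {a b} (p : Fin n) → (∀ i → a i B.≤ b i) → a p ≡ false → b p ≡ true →
    weight a + w p ≤ weight b
  weight-add {a} {b} p a≤b ap bp = subst (weight a + w p ≤_) (+-identityʳ (weight b))
    (Σ-mono-except _ _ p (λ i _ → select-mono i (a≤b i)) at-p)
    where
    at-p : select (a p) p + w p ≤ select (b p) p + 0
    at-p rewrite ap | bp = ≤-reflexive (sym (+-identityʳ (w p)))

  weight-remove-last : ∀ {a} (q : Fin n) → (∀ i → q F.< i → a i ≡ false) →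
    weight a ≤ weight (below q a) + w q
  weight-remove-last {a} q beyond = subst (_≤ weight (below q a) + w q) (+-identityʳ (weight a))
    (Σ-mono-except _ _ q off-q at-q)
    where
    at-q : select (a q) q + 0 ≤ select (below q a q) q + w q
    at-q rewrite below-≥ a (≤-refl {toℕ q}) | +-identityʳ (select (a q) q) with a q
    ... | true  = ≤-refl
    ... | false = z≤n
    off-q : ∀ i → i ≢ q → select (a i) i ≤ select (below q a i) i
    off-q i i≢q with i <? q
    ... | yes _   = ≤-refl
    ... | no  i≮q rewrite beyond i (FP.≤∧≢⇒< (≮⇒≥ i≮q) (i≢q ∘ sym)) = z≤n

module Critical {n : ℕ} (w : Fin n → ℕ) (C : ℕ) where

  open Weight w

  record CriticalAt (a : Fin n → Bool) (q : Fin n) : Set where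
    field
      beyond  : ∀ i → q F.< i → a i ≡ false
      at-last : a q ≡ true
      exceeds : C < weight a
      fits    : weight (below q a) ≤ C

  open CriticalAt

  critical-index : ∀ {a b q q'} → CriticalAt a q → CriticalAt b q' →
    (∀ i → a i B.≤ b i) → q ≡ q'
  critical-index {a} {b} {q} {q'} ca cb a≤b = FP.≤-antisym q≤q' q'≤q
    where
    -- b has a 1 at q, so q does not lie beyond q'.
    q≤q' : q F.≤ q'
    q≤q' with q F.≤? q'
    ... | yes q≤q' = q≤q'
    ... | no  q≰q' with () ← trans (sym (true≤⇒true (subst (B._≤ b q) (at-last ca) (a≤b q))))
                                   (beyond cb q (≰⇒> q≰q'))
    -- If q < q', then a lies below b restricted to indices < q', which fits.
    a≤below : q F.< q' → ∀ i → a i B.≤ below q' b i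
    a≤below q<q' i with i <? q'
    ... | yes _   = a≤b i
    ... | no  i≮q' rewrite beyond ca i (<-≤-trans q<q' (≮⇒≥ i≮q')) = B.b≤b
    q'≤q : q' F.≤ q
    q'≤q with q' F.≤? q
    ... | yes q'≤q = q'≤q
    ... | no  q'≰q = contradiction (≤-trans (weight-mono (a≤below (≰⇒> q'≰q))) (fits cb))
                                    (<⇒≱ (exceeds ca))

  critical-antichain : (∀ i j → i F.≤ j → w j ≤ w i) → ∀ {a b q q'} →
    CriticalAt a q → CriticalAt b q' → (∀ i → a i B.≤ b i) → a ≗ b
  critical-antichain antitone {a} {b} {q} ca cb a≤b p with critical-index ca cb a≤b
  ... | refl = bit-equal (a p) (b p) refl refl (a≤b p)
    where
    -- A position p with a p = 0 and b p = 1 lies strictly below q: not at q,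
    -- where a has a 1, and not beyond q, where b vanishes.
    p<q : a p ≡ false → b p ≡ true → p F.< q
    p<q ap bp with p <? q
    ... | yes p<q = p<q
    ... | no  p≮q with q FP.≟ p
    ...   | yes refl = contradiction (trans (sym (at-last ca)) ap) (λ ())
    ...   | no  q≢p  = contradiction (trans (sym (beyond cb p (FP.≤∧≢⇒< (≮⇒≥ p≮q) q≢p))) bp) (λ ())
    impossible : a p ≡ false → b p ≡ true → C < C
    impossible ap bp = begin-strict
      C                             <⟨ exceeds ca ⟩
      weight a                      ≤⟨ weight-remove-last q (beyond ca) ⟩
      weight (below q a) + w q      ≤⟨ +-monoʳ-≤ _ (antitone p q (<⇒≤ (p<q ap bp))) ⟩
      weight (below q a) + w p      ≤⟨ weight-add p (below-mono q a≤b) (trans (below-< a (p<q ap bp)) ap)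
                                                                        (trans (below-< b (p<q ap bp)) bp) ⟩
      weight (below q b)            ≤⟨ fits cb ⟩
      C                             ∎
      where open ≤-Reasoning
    bit-equal : ∀ x y → a p ≡ x → b p ≡ y → x B.≤ y → x ≡ y
    bit-equal false true  ap bp _ = contradiction (impossible ap bp) (<-irrefl refl)
    bit-equal false false _  _  _ = refl
    bit-equal true  true  _  _  _ = refl

extend-at : ∀ {n} (μ : Map n) (i : Fin n) (k : Bool) → extend μ i k i ≡ just k
extend-at μ i k with i FP.≟ i
... | yes _   = refl
... | no  i≢i = contradiction refl i≢i

extend-other : ∀ {n} (μ : Map n) {i j : Fin n} (k : Bool) → j ≢ i → extend μ i k j ≡ μ j
extend-other μ {i} {j} k j≢i with j FP.≟ i
... | yes j≡i = contradiction j≡i j≢i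
... | no  _   = refl

record DefinedBelow {n : ℕ} (μ : Map n) (m : ℕ) : Set where
  field
    defined   : ∀ i → toℕ i < m → μ i ≢ nothing
    undefined : ∀ i → m ≤ toℕ i → μ i ≡ nothing

open DefinedBelow

smallestFree-index : ∀ {n} {μ : Map n} {m i} → DefinedBelow μ m → SmallestFree μ i → toℕ i ≡ m
smallestFree-index {m = m} {i} dμ (free , least) = ≤-antisym i≤m m≤i
  where
  m≤i : m ≤ toℕ i
  m≤i = ≮⇒≥ (λ i<m → defined dμ i i<m free)
  -- Otherwise the index m itself would be a smaller free index.
  i≤m : toℕ i ≤ m
  i≤m = ≮⇒≥ λ m<i →
    let m<n = <-≤-trans m<i (<⇒≤ (toℕ<n i))
        j   = fromℕ< m<n
    in least j (subst (_< toℕ i) (sym (toℕ-fromℕ< m<n)) m<i)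
               (undefined dμ j (≤-reflexive (sym (toℕ-fromℕ< m<n))))

extend-defined : ∀ {n} {μ : Map n} {i} (k : Bool) → DefinedBelow μ (toℕ i) →
  DefinedBelow (extend μ i k) (suc (toℕ i))
extend-defined {μ = μ} {i} k dμ = record { defined = defined′ ; undefined = undefined′ }
  where
  defined′ : ∀ j → toℕ j < suc (toℕ i) → extend μ i k j ≢ nothing
  defined′ j j≤i with j FP.≟ i
  ... | yes refl = λ ()
  ... | no  j≢i  = defined dμ j (≤∧≢⇒< (s≤s⁻¹ j≤i) (j≢i ∘ toℕ-injective))
  undefined′ : ∀ j → suc (toℕ i) ≤ toℕ j → extend μ i k j ≡ nothing
  undefined′ j i<j = trans (extend-other μ k (λ { refl → <-irrefl refl i<j }))
                           (undefined dμ j (<⇒≤ i<j))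

module Tree {n : ℕ} (w : Fin n → ℕ) (C : ℕ) where

  node-shape : ∀ {μ} → InTree w C μ → ∃ (DefinedBelow μ)
  node-shape rootIn = 0 , record { defined = λ _ () ; undefined = λ _ _ → refl }
  node-shape (childIn t _ _ i free k) with node-shape t
  ... | m , dμ with refl ← smallestFree-index dμ free = suc m , extend-defined k dμ

  open Weight w
  open Critical w C

  bits-extend-false : ∀ {μ : Map n} {i} → μ i ≡ nothing → bits (extend μ i false) ≗ bits μ
  bits-extend-false {μ} {i} free j with j FP.≟ i
  ... | yes refl rewrite free = refl
  ... | no  _    = refl

  below-extend : ∀ {μ : Map n} {i} (k : Bool) → DefinedBelow μ (toℕ i) →
    below i (bits (extend μ i k)) ≗ bits μ
  below-extend {μ} {i} k dμ j with j <? i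
  ... | yes j<i = cong (fromMaybe false) (extend-other μ k (FP.<⇒≢ j<i))
  ... | no  j≮i = cong (fromMaybe false) (sym (undefined dμ j (≮⇒≥ j≮i)))

  -- The 0-tuple of a leaf satisfying the C0-condition is critical: the
  -- parent fits, so the last assigned bit must be a 1 and it is the last 1.
  leaf-critical : ∀ {μ} → InTree w C μ → C0 w C μ → ∃ (CriticalAt (bits μ))
  leaf-critical rootIn c0 = contradiction (subst (C <_) (trans (ones-weight root) weight-empty) c0) λ ()
  leaf-critical (childIn {μ} _ ¬c0 _ i (free , _) false) c0 =
    contradiction (subst (C <_) same-weight c0) ¬c0
    where
    same-weight : Σ[ ones w (extend μ i false) ] ≡ Σ[ ones w μ ]
    same-weight = begin
      Σ[ ones w (extend μ i false) ]   ≡⟨ ones-weight (extend μ i false) ⟩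
      weight (bits (extend μ i false)) ≡⟨ weight-cong (bits-extend-false {μ} {i} free) ⟩
      weight (bits μ)                  ≡⟨ ones-weight μ ⟨
      Σ[ ones w μ ]                    ∎
      where open ≡-Reasoning
  leaf-critical (childIn {μ} t ¬c0 _ i sf true) c0 with node-shape t
  ... | m , dμ with refl ← smallestFree-index dμ sf = i , record
    { beyond  = λ j i<j → cong (fromMaybe false) (undefined (extend-defined true dμ) j i<j)
    ; at-last = cong (fromMaybe false) (extend-at μ i true)
    ; exceeds = subst (C <_) (ones-weight (extend μ i true)) c0
    ; fits    = subst (_≤ C) (trans (ones-weight μ) (sym (weight-cong (below-extend {μ} {i} true dμ))))
                        (≮⇒≥ ¬c0)
    }

  leaf-tuple : ∀ {z} → IsLeaf0Tuple w C z → ∃[ a ] (∃ (CriticalAt a) × z ≡ tabulate a)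
  leaf-tuple (μ , t , c0 , refl) = bits μ , leaf-critical t c0 , zeroTuple-tabulate μ

proposition5 : (n : ℕ) (w : Fin n → ℕ) (C : ℕ) →
    (∀ i → 0 < w i) → (∀ i j → i F.≤ j → w j ≤ w i) → 0 < C →
    (z₁ z₂ : Vec Bool n) → IsLeaf0Tuple w C z₁ → IsLeaf0Tuple w C z₂ →
    z₁ ≢ z₂ → Incomparable z₁ z₂
proposition5 n w C _ antitone _ z₁ z₂ leaf₁ leaf₂ z₁≢z₂
  with Tree.leaf-tuple w C leaf₁ | Tree.leaf-tuple w C leaf₂
... | a , (_ , ca) , refl | b , (_ , cb) , refl =
  not-below ca cb z₁≢z₂ , not-below cb ca (z₁≢z₂ ∘ sym)
  where
  open Critical w C
  not-below : ∀ {a b q q'} → CriticalAt a q → CriticalAt b q' →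
    tabulate a ≢ tabulate b → ¬ (tabulate a ≤ᵥ tabulate b)
  not-below ca cb a≢b a≤b = a≢b (tabulate-cong (critical-antichain antitone ca cb (tabulate⁻ a≤b)))
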